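{- Let $p\equiv1\pmod4$ be prime, let $a$ be an odd integer with $(a,p)=1$, and let $S(y)=\sum_{\mu=0}^{p-1}\sum_{\nu=0}^{p-1}\mu\chi_\nu\big\lfloor\frac{a\mu+ay+\nu}{p}\big\rfloor$. Then $S(\tfrac12)\equiv0\pmod2$.
   Context: $\chi_\nu=\left(\frac{\nu}{p}\right)$ is the Legendre symbol mod $p$, and $\lfloor\cdot\rfloor$ is the floor function. -}

module Defs where

open import Data.Nat as ℕ using (ℕ; zero; suc; NonZero)
open import Data.Nat.DivMod using (_%_)
open import Data.Bool using (Bool; if_then_else_)
open import Data.List using (List; upTo; foldr; map)
open import Data.Bool.ListAction using (any)
open import Data.Integer as ℤ using (ℤ; +_; -_; 0ℤ; 1ℤ; -1ℤ)
open import Data.Rational as ℚ using (ℚ)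

Σℤ : ℕ → (ℕ → ℤ) → ℤ
Σℤ n f = foldr ℤ._+_ 0ℤ (map f (upTo n))

-- ν is a quadratic residue mod p: some x ∈ {0,…,p-1} with x² ≡ ν (mod p)
-- (decided by exhaustive search; any square root can be reduced mod p).
isQRᵇ : (p : ℕ) .{{_ : NonZero p}} → ℕ → Bool
isQRᵇ p ν = any (λ x → ((x ℕ.* x) % p) ℕ.≡ᵇ (ν % p)) (upTo p)

legendre : (p : ℕ) .{{_ : NonZero p}} → ℕ → ℤ
legendre p ν =
  if (ν % p) ℕ.≡ᵇ 0 then 0ℤ else (if isQRᵇ p ν then 1ℤ else -1ℤ)

S : (p : ℕ) .{{_ : NonZero p}} → ℤ → ℚ → ℤ
S p a y =
  Σℤ p (λ μ → Σℤ p (λ ν →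
    (+ μ) ℤ.* legendre p ν ℤ.*
      ℚ.floor ((((a ℤ.* + μ ℤ.+ + ν) ℚ./ 1) ℚ.+ ((a ℚ./ 1) ℚ.* y)) ℚ.* (+ 1 ℚ./ p))))

-- Let H(μ) = Σ_{ν=1}^{p-1} ⌊(aμ + ν + a/2)/p⌋. The ν = 0 terms of S(½) vanish and χ_ν = ±1 is odd
-- for 0 < ν < p, so S(½) ≡ Σ_μ μ H(μ) (mod 2). The floor's argument is N/2p with N = 2(aμ + ν) + a
-- odd, and (μ, ν) ↦ (p-1-μ, p-ν) turns N into (a+1)·2p - N; since 2p ∤ N this gives
-- ⌊(a+1) - N/2p⌋ = a - ⌊N/2p⌋, whence H(p-1-μ) = (p-1)a - H(μ). As p - 1 is even, the terms μ and
-- p-1-μ of Σ_μ μ H(μ) add up to an even number, and the unpaired middle term ((p-1)/2)·H((p-1)/2)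
-- is even because 4 ∣ p - 1.

module Submission where

open import Defs
open import Data.Nat as ℕ using (ℕ; zero; suc; NonZero)
import Data.Nat.Properties as ℕ
open import Data.Nat.DivMod using (_%_; _/_; m≡m%n+[m/n]*n; m<n⇒m%n≡m)
open import Data.Nat.Primality using (Prime)
open import Data.Nat.Coprimality using (Coprime)
open import Data.Nat.Tactic.RingSolver as ℕ-Ring using ()
open import Data.Bool using (true; false)
open import Data.Integer as ℤ using (ℤ; +_; ∣_∣; 0ℤ; 1ℤ; -1ℤ; _+_; _*_; _-_; _≤_; _<_; +≤+; +<+)
open import Data.Integer.Properties
open import Data.Integer.DivMod using (a≡a%n+[a/n]*n; n%d<d)
open import Data.Integer.Divisibility using (_∣_)
open import Data.Integer.Divisibility.Signed
  using (divides; ∣-refl; ∣-trans; ∣⇒∣ᵤ; ∣m∣n⇒∣m+n; ∣m∣n⇒∣m-n; ∣m⇒∣-m; ∣m+n∣m⇒∣n; ∣m+n∣n⇒∣m; ∣m⇒∣m*n)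
  renaming (_∣_ to _∣ₛ_)
open import Data.Integer.GCD using (gcd)
open import Data.Integer.Tactic.RingSolver using (solve-∀)
open import Data.List using (foldr)
open import Data.List.Properties using (map-applyUpTo; map-upTo)
open import Data.Rational as ℚ using (ℚ; mkℚ; ½; ↥_; ↧_; toℚᵘ)
open import Data.Rational.Properties using (↥-/; ↧-/; ↥ᵘ-toℚᵘ; ↧ᵘ-toℚᵘ; toℚᵘ-homo-+; toℚᵘ-homo-*)
open import Data.Rational.Unnormalised as ℚᵘ using (mkℚᵘ; *≡*; _≃_)
open import Data.Rational.Unnormalised.Properties
  using (+-cong; *-cong; ≃-refl; drop-*≡*; module ≃-Reasoning)
open import Function using (_∘_)
open import Relation.Binary.PropositionalEquality
open import Relation.Nullary using (¬_)

record FloorDiv (d : ℕ) (x q : ℤ) : Set where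
  constructor floorDiv
  field
    remainder       : ℤ
    0≤remainder     : 0ℤ ≤ remainder
    remainder<d     : remainder < + d
    x≡remainder+q*d : x ≡ remainder + q * + d

private
  floorDiv-≤ : ∀ {d r r' q q'} → 0ℤ ≤ r' → r < + d → r + q * + d ≡ r' + q' * + d → q' ≤ q
  floorDiv-≤ {d} {r} {r'} {q} {q'} 0≤r' r<d eq = ≮⇒≥ λ q<q' → <-irrefl refl (r+qd<r+qd q<q')
    where
    open ≤-Reasoning
    d+qd≡[1+q]d : ∀ d q → d + q * d ≡ (1ℤ + q) * d
    d+qd≡[1+q]d = solve-∀
    r+qd<r+qd : q < q' → r + q * + d < r + q * + d
    r+qd<r+qd q<q' = begin-strict
      r + q * + d        ≡⟨ +-comm r _ ⟩
      q * + d + r        <⟨ +-monoʳ-< (q * + d) r<d ⟩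
      q * + d + + d      ≡⟨ +-comm (q * + d) (+ d) ⟩
      + d + q * + d      ≡⟨ d+qd≡[1+q]d (+ d) q ⟩
      (1ℤ + q) * + d     ≤⟨ *-monoʳ-≤-nonNeg (+ d) (i<j⇒suc[i]≤j q<q') ⟩
      q' * + d           ≡⟨ +-identityˡ _ ⟨
      0ℤ + q' * + d      ≤⟨ +-monoˡ-≤ (q' * + d) 0≤r' ⟩
      r' + q' * + d      ≡⟨ eq ⟨
      r + q * + d        ∎

floorDiv-unique : ∀ {d x q q'} → FloorDiv d x q → FloorDiv d x q' → q ≡ q'
floorDiv-unique (floorDiv r 0≤r r<d x≡) (floorDiv r' 0≤r' r'<d x≡') =
  ≤-antisym (floorDiv-≤ 0≤r r'<d (trans (sym x≡') x≡))
            (floorDiv-≤ 0≤r' r<d (trans (sym x≡) x≡'))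

floorDiv-/ : ∀ d x → FloorDiv (suc d) x (x ℤ./ + suc d)
floorDiv-/ d x = floorDiv _ (+≤+ ℕ.z≤n) (+<+ (n%d<d x (+ suc d))) (a≡a%n+[a/n]*n x (+ suc d))

floorDiv-rescale : ∀ {d D x n q} → FloorDiv (suc d) x q → x * + suc D ≡ n * + suc d →
                   FloorDiv (suc D) n q
floorDiv-rescale {d} {D} {x} {n} {q} (floorDiv R 0≤R R<d x≡) x*D≡n*d =
  floorDiv (n - q * + suc D) 0≤r r<D (n≡[n-m]+m n (q * + suc D))
  where
  n≡[n-m]+m : ∀ n m → n ≡ (n - m) + m
  n≡[n-m]+m = solve-∀
  distrib : ∀ n m d → (n - m) * d ≡ n * d - m * d
  distrib = solve-∀
  cancel : ∀ R q d D → (R + q * d) * D - q * D * d ≡ R * D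
  cancel = solve-∀
  r*d≡R*D : (n - q * + suc D) * + suc d ≡ R * + suc D
  r*d≡R*D = begin
    (n - q * + suc D) * + suc d                         ≡⟨ distrib n (q * + suc D) (+ suc d) ⟩
    n * + suc d - q * + suc D * + suc d                 ≡⟨ cong (_- q * + suc D * + suc d) x*D≡n*d ⟨
    x * + suc D - q * + suc D * + suc d                 ≡⟨ cong (λ t → t * + suc D - q * + suc D * + suc d) x≡ ⟩
    (R + q * + suc d) * + suc D - q * + suc D * + suc d ≡⟨ cancel R q (+ suc d) (+ suc D) ⟩
    R * + suc D                                         ∎
    where open ≡-Reasoning
  0≤r : 0ℤ ≤ n - q * + suc D
  0≤r = *-cancelʳ-≤-pos 0ℤ _ (+ suc d)
          (subst (0ℤ ≤_) (sym r*d≡R*D) (*-monoʳ-≤-nonNeg (+ suc D) 0≤R))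
  r<D : n - q * + suc D < + suc D
  r<D = *-cancelʳ-<-nonNeg (+ suc d)
          (subst₂ _<_ (sym r*d≡R*D) (*-comm (+ suc d) (+ suc D)) (*-monoʳ-<-pos (+ suc D) R<d))

floorDiv-complement : ∀ {d x y q} c → FloorDiv d x q → ¬ (+ d ∣ₛ x) → x + y ≡ c * + d →
                      FloorDiv d y (c - q - 1ℤ)
floorDiv-complement {d} {x} {y} {q} c (floorDiv r 0≤r r<d x≡) d∤x x+y≡c*d =
  floorDiv (+ d - r) (i≤j⇒0≤j-i (<⇒≤ r<d)) d-r<d y≡
  where
  0<r : 0ℤ < r
  0<r = ≤∧≢⇒< 0≤r λ 0≡r →
    d∤x (divides q (trans x≡ (trans (cong (_+ q * + d) (sym 0≡r)) (+-identityˡ (q * + d)))))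
  d-r<d : + d - r < + d
  d-r<d = subst (+ d - r <_) (+-identityʳ (+ d)) (+-monoʳ-< (+ d) (neg-mono-< 0<r))
  cancel : ∀ x y → y ≡ (x + y) - x
  cancel = solve-∀
  regroup : ∀ r q c d → c * d - (r + q * d) ≡ (d - r) + (c - q - 1ℤ) * d
  regroup = solve-∀
  y≡ : y ≡ (+ d - r) + (c - q - 1ℤ) * + d
  y≡ = begin
    y                            ≡⟨ cancel x y ⟩
    (x + y) - x                  ≡⟨ cong₂ _-_ x+y≡c*d x≡ ⟩
    c * + d - (r + q * + d)      ≡⟨ regroup r q c (+ d) ⟩
    (+ d - r) + (c - q - 1ℤ) * + d ∎
    where open ≡-Reasoning

floor-floorDiv : ∀ q n D → ↥ q * + suc D ≡ n * ↧ q → FloorDiv (suc D) n (ℚ.floor q)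
floor-floorDiv (mkℚ m d _) n D = floorDiv-rescale (floorDiv-/ d m)

toℚᵘ-/ : ∀ i n → toℚᵘ (i ℚ./ suc n) ≃ mkℚᵘ i n
toℚᵘ-/ i n = *≡* (begin
  ℚᵘ.↥ toℚᵘ q * + suc n ≡⟨ cong (_* + suc n) (↥ᵘ-toℚᵘ q) ⟩
  ↥ q * + suc n         ≡⟨ cong (↥ q *_) (↧-/ i (suc n)) ⟨
  ↥ q * (↧ q * g)       ≡⟨ reassoc (↥ q) (↧ q) g ⟩
  (↥ q * g) * ↧ q       ≡⟨ cong (_* ↧ q) (↥-/ i (suc n)) ⟩
  i * ↧ q               ≡⟨ cong (i *_) (↧ᵘ-toℚᵘ q) ⟨
  i * ℚᵘ.↧ toℚᵘ q       ∎)
  where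
  open ≡-Reasoning
  q = i ℚ./ suc n
  g = gcd i (+ suc n)
  reassoc : ∀ x y z → x * (y * z) ≡ (x * z) * y
  reassoc = solve-∀

Σℤ-suc : ∀ n f → Σℤ (suc n) f ≡ f 0 + Σℤ n (f ∘ suc)
Σℤ-suc n f = cong (λ xs → f 0 + foldr _+_ 0ℤ xs)
  (trans (map-applyUpTo suc f n) (sym (map-upTo (f ∘ suc) n)))

Σℤ-snoc : ∀ n f → Σℤ (suc n) f ≡ Σℤ n f + f n
Σℤ-snoc zero    f = trans (Σℤ-suc 0 f) (+-comm (f 0) 0ℤ)
Σℤ-snoc (suc n) f = begin
  Σℤ (suc (suc n)) f                  ≡⟨ Σℤ-suc (suc n) f ⟩
  f 0 + Σℤ (suc n) (f ∘ suc)          ≡⟨ cong (_+_ (f 0)) (Σℤ-snoc n (f ∘ suc)) ⟩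
  f 0 + (Σℤ n (f ∘ suc) + f (suc n))  ≡⟨ +-assoc (f 0) _ _ ⟨
  (f 0 + Σℤ n (f ∘ suc)) + f (suc n)  ≡⟨ cong (_+ f (suc n)) (Σℤ-suc n f) ⟨
  Σℤ (suc n) f + f (suc n)            ∎
  where open ≡-Reasoning

Σℤ-reverse : ∀ n f g → (∀ i j → suc (i ℕ.+ j) ≡ n → g i ≡ f j) → Σℤ n g ≡ Σℤ n f
Σℤ-reverse zero    f g _        = refl
Σℤ-reverse (suc n) f g reversed = begin
  Σℤ (suc n) g            ≡⟨ Σℤ-suc n g ⟩
  g 0 + Σℤ n (g ∘ suc)    ≡⟨ cong₂ _+_ (reversed 0 n refl) (Σℤ-reverse n f (g ∘ suc) reversed-suc) ⟩
  f n + Σℤ n f            ≡⟨ +-comm (f n) (Σℤ n f) ⟩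
  Σℤ n f + f n            ≡⟨ Σℤ-snoc n f ⟨
  Σℤ (suc n) f            ∎
  where
  open ≡-Reasoning
  reversed-suc : ∀ i j → suc (i ℕ.+ j) ≡ n → g (suc i) ≡ f j
  reversed-suc i j e = reversed (suc i) j (cong suc e)

Σℤ-sub : ∀ n f g → Σℤ n (λ i → f i - g i) ≡ Σℤ n f - Σℤ n g
Σℤ-sub zero    f g = refl
Σℤ-sub (suc n) f g = begin
  Σℤ (suc n) (λ i → f i - g i)                          ≡⟨ Σℤ-suc n (λ i → f i - g i) ⟩
  (f 0 - g 0) + Σℤ n (λ i → f (suc i) - g (suc i))      ≡⟨ cong (_+_ (f 0 - g 0)) (Σℤ-sub n (f ∘ suc) (g ∘ suc)) ⟩
  (f 0 - g 0) + (Σℤ n (f ∘ suc) - Σℤ n (g ∘ suc))       ≡⟨ interchange (f 0) (g 0) _ _ ⟩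
  (f 0 + Σℤ n (f ∘ suc)) - (g 0 + Σℤ n (g ∘ suc))       ≡⟨ cong₂ _-_ (Σℤ-suc n f) (Σℤ-suc n g) ⟨
  Σℤ (suc n) f - Σℤ (suc n) g                           ∎
  where
  open ≡-Reasoning
  interchange : ∀ a b c d → (a - b) + (c - d) ≡ (a + c) - (b + d)
  interchange = solve-∀

Σℤ-*ˡ : ∀ n c f → Σℤ n (λ i → c * f i) ≡ c * Σℤ n f
Σℤ-*ˡ zero    c f = sym (*-zeroʳ c)
Σℤ-*ˡ (suc n) c f = begin
  Σℤ (suc n) (λ i → c * f i)          ≡⟨ Σℤ-suc n (λ i → c * f i) ⟩
  c * f 0 + Σℤ n (λ i → c * f (suc i)) ≡⟨ cong (_+_ (c * f 0)) (Σℤ-*ˡ n c (f ∘ suc)) ⟩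
  c * f 0 + c * Σℤ n (f ∘ suc)        ≡⟨ *-distribˡ-+ c (f 0) _ ⟨
  c * (f 0 + Σℤ n (f ∘ suc))          ≡⟨ cong (c *_) (Σℤ-suc n f) ⟨
  c * Σℤ (suc n) f                    ∎
  where open ≡-Reasoning

Σℤ-const : ∀ n c → Σℤ n (λ _ → c) ≡ + n * c
Σℤ-const zero    c = sym (*-zeroˡ c)
Σℤ-const (suc n) c = begin
  Σℤ (suc n) (λ _ → c)   ≡⟨ Σℤ-suc n (λ _ → c) ⟩
  c + Σℤ n (λ _ → c)     ≡⟨ cong (_+_ c) (Σℤ-const n c) ⟩
  c + + n * c            ≡⟨ step c (+ n) ⟩
  (+ 1 + + n) * c        ≡⟨ cong (_* c) (pos-+ 1 n) ⟨
  + suc n * c            ∎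
  where
  open ≡-Reasoning
  step : ∀ c n → c + n * c ≡ (+ 1 + n) * c
  step = solve-∀

∣Σℤ : ∀ {k} n f → (∀ i → i ℕ.< n → k ∣ₛ f i) → k ∣ₛ Σℤ n f
∣Σℤ {k} zero    f _   = divides 0ℤ (sym (*-zeroˡ k))
∣Σℤ {k} (suc n) f k∣f = subst (k ∣ₛ_) (sym (Σℤ-suc n f))
  (∣m∣n⇒∣m+n (k∣f 0 (ℕ.s≤s ℕ.z≤n)) (∣Σℤ n (f ∘ suc) λ i i<n → k∣f (suc i) (ℕ.s≤s i<n)))

∣Σℤ-pairs : ∀ {k} m f → k ∣ₛ f m → (∀ i j → i ℕ.+ j ≡ 2 ℕ.* m → k ∣ₛ f i + f j) →
            k ∣ₛ Σℤ (suc (2 ℕ.* m)) f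
∣Σℤ-pairs {k} zero    f k∣f0  _     = subst (k ∣ₛ_) (sym (trans (Σℤ-suc 0 f) (+-identityʳ (f 0)))) k∣f0
∣Σℤ-pairs {k} (suc m) f k∣mid pairs = subst (k ∣ₛ_) (sym split)
  (∣m∣n⇒∣m+n (∣Σℤ-pairs m (f ∘ suc) k∣mid inner-pairs) (pairs 0 (2 ℕ.+ 2 ℕ.* m) (sym (ℕ.*-suc 2 m))))
  where
  inner-pairs : ∀ i j → i ℕ.+ j ≡ 2 ℕ.* m → k ∣ₛ f (suc i) + f (suc j)
  inner-pairs i j i+j≡2m = pairs (suc i) (suc j)
    (trans (cong suc (trans (ℕ.+-suc i j) (cong suc i+j≡2m))) (sym (ℕ.*-suc 2 m)))
  rotate : ∀ x y z → x + (y + z) ≡ y + (x + z)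
  rotate = solve-∀
  inner = Σℤ (suc (2 ℕ.* m)) (f ∘ suc)
  last  = f (2 ℕ.+ 2 ℕ.* m)
  split : Σℤ (suc (2 ℕ.* suc m)) f ≡ inner + (f 0 + last)
  split = begin
    Σℤ (suc (2 ℕ.* suc m)) f                    ≡⟨ cong (λ n → Σℤ (suc n) f) (ℕ.*-suc 2 m) ⟩
    Σℤ (3 ℕ.+ 2 ℕ.* m) f                        ≡⟨ Σℤ-suc (2 ℕ.+ 2 ℕ.* m) f ⟩
    f 0 + Σℤ (2 ℕ.+ 2 ℕ.* m) (f ∘ suc)          ≡⟨ cong (_+_ (f 0)) (Σℤ-snoc (suc (2 ℕ.* m)) (f ∘ suc)) ⟩
    f 0 + (inner + last)                        ≡⟨ rotate (f 0) inner last ⟩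
    inner + (f 0 + last)                        ∎
    where open ≡-Reasoning

2∣+[2*n] : ∀ n → + 2 ∣ₛ + (2 ℕ.* n)
2∣+[2*n] n = divides (+ n) (trans (pos-* 2 n) (*-comm (+ 2) (+ n)))

legendre-odd : ∀ p .{{_ : NonZero p}} j → suc j ℕ.< p → + 2 ∣ₛ legendre p (suc j) - 1ℤ
legendre-odd p j j<p with isQRᵇ p (suc j)
... | true  rewrite m<n⇒m%n≡m j<p = divides 0ℤ refl
... | false rewrite m<n⇒m%n≡m j<p = divides -1ℤ refl

-- Spelled exactly as the summand of S, so that S p a ½ unfolds to the double sum of floorTerm.
floorArgument : (p : ℕ) .{{_ : NonZero p}} → ℤ → ℕ → ℕ → ℚ
floorArgument p a μ ν = (((a * + μ + + ν) ℚ./ 1) ℚ.+ ((a ℚ./ 1) ℚ.* ½)) ℚ.* (+ 1 ℚ./ p)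

floorTerm : (p : ℕ) .{{_ : NonZero p}} → ℤ → ℕ → ℕ → ℤ
floorTerm p a μ ν = ℚ.floor (floorArgument p a μ ν)

numerator : ℤ → ℕ → ℕ → ℤ
numerator a μ ν = + 2 * (a * + μ + + ν) + a

floorArgument-≃ : ∀ P a μ ν →
  toℚᵘ (floorArgument (suc P) a μ ν) ≃ mkℚᵘ (numerator a μ ν) (ℕ.pred (2 ℕ.* suc P))
floorArgument-≃ P a μ ν = begin
  toℚᵘ ((A ℚ.+ B) ℚ.* C)
    ≈⟨ toℚᵘ-homo-* (A ℚ.+ B) C ⟩
  toℚᵘ (A ℚ.+ B) ℚᵘ.* toℚᵘ C
    ≈⟨ *-cong (toℚᵘ-homo-+ A B) (toℚᵘ-/ (+ 1) P) ⟩
  (toℚᵘ A ℚᵘ.+ toℚᵘ B) ℚᵘ.* mkℚᵘ (+ 1) P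
    ≈⟨ *-cong (+-cong (toℚᵘ-/ m 0) (toℚᵘ-homo-* (a ℚ./ 1) ½)) ≃-refl ⟩
  (mkℚᵘ m 0 ℚᵘ.+ toℚᵘ (a ℚ./ 1) ℚᵘ.* toℚᵘ ½) ℚᵘ.* mkℚᵘ (+ 1) P
    ≈⟨ *-cong (+-cong ≃-refl (*-cong (toℚᵘ-/ a 0) ≃-refl)) ≃-refl ⟩
  (mkℚᵘ m 0 ℚᵘ.+ mkℚᵘ a 0 ℚᵘ.* mkℚᵘ (+ 1) 1) ℚᵘ.* mkℚᵘ (+ 1) P
    ≈⟨ *≡* (clear m a (+ suc P)) ⟩
  mkℚᵘ (numerator a μ ν) (ℕ.pred (2 ℕ.* suc P))
    ∎
  where
  open ≃-Reasoning
  m = a * + μ + + ν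
  A = m ℚ./ 1
  B = (a ℚ./ 1) ℚ.* ½
  C = + 1 ℚ./ suc P
  -- the two sides of ≃ after cross-multiplying the unnormalised sum and products
  clear : ∀ m a p → ((m * + 2 + a * + 1 * + 1) * + 1) * (+ 2 * p) ≡ (+ 2 * m + a) * (+ 2 * p)
  clear = solve-∀

floorTerm-floorDiv : ∀ P a μ ν → FloorDiv (2 ℕ.* suc P) (numerator a μ ν) (floorTerm (suc P) a μ ν)
floorTerm-floorDiv P a μ ν = floor-floorDiv E (numerator a μ ν) _ (begin
  ↥ E * + (2 ℕ.* suc P)                   ≡⟨ cong (_* + (2 ℕ.* suc P)) (↥ᵘ-toℚᵘ E) ⟨
  ℚᵘ.↥ toℚᵘ E * + (2 ℕ.* suc P)          ≡⟨ drop-*≡* (floorArgument-≃ P a μ ν) ⟩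
  numerator a μ ν * ℚᵘ.↧ toℚᵘ E          ≡⟨ cong (numerator a μ ν *_) (↧ᵘ-toℚᵘ E) ⟩
  numerator a μ ν * ↧ E                   ∎)
  where
  open ≡-Reasoning
  E = floorArgument (suc P) a μ ν

numerator-odd : ∀ {a} μ ν → ¬ + 2 ∣ₛ a → ¬ + 2 ∣ₛ numerator a μ ν
numerator-odd {a} μ ν 2∤a 2∣N = 2∤a (∣m+n∣m⇒∣n 2∣N (∣m⇒∣m*n (a * + μ + + ν) ∣-refl))

numerator-complement : ∀ {P} a {μ μ' ν ν'} → μ ℕ.+ μ' ≡ P → ν ℕ.+ ν' ≡ suc P →
                       numerator a μ ν + numerator a μ' ν' ≡ (a + 1ℤ) * + (2 ℕ.* suc P)
numerator-complement {P} a {μ} {μ'} {ν} {ν'} μ+μ'≡P ν+ν'≡p = begin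
  numerator a μ ν + numerator a μ' ν'
    ≡⟨ collect a (+ μ) (+ μ') (+ ν) (+ ν') ⟩
  + 2 * (a * (+ μ + + μ') + (+ ν + + ν')) + + 2 * a
    ≡⟨ cong₂ (λ s t → + 2 * (a * s + t) + + 2 * a) (+-sum μ μ' μ+μ'≡P) (+-sum ν ν' ν+ν'≡p) ⟩
  + 2 * (a * + P + + suc P) + + 2 * a
    ≡⟨ cong (λ t → + 2 * (a * + P + t) + + 2 * a) (pos-+ 1 P) ⟩
  + 2 * (a * + P + (1ℤ + + P)) + + 2 * a
    ≡⟨ factor a (+ P) ⟩
  (a + 1ℤ) * (+ 2 * (1ℤ + + P))
    ≡⟨ cong (λ t → (a + 1ℤ) * (+ 2 * t)) (pos-+ 1 P) ⟨
  (a + 1ℤ) * (+ 2 * + suc P)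
    ≡⟨ cong ((a + 1ℤ) *_) (pos-* 2 (suc P)) ⟨
  (a + 1ℤ) * + (2 ℕ.* suc P) ∎
  where
  open ≡-Reasoning
  +-sum : ∀ m n {s} → m ℕ.+ n ≡ s → + m + + n ≡ + s
  +-sum m n refl = sym (pos-+ m n)
  collect : ∀ a m m' n n' → (+ 2 * (a * m + n) + a) + (+ 2 * (a * m' + n') + a)
                          ≡ + 2 * (a * (m + m') + (n + n')) + + 2 * a
  collect = solve-∀
  factor : ∀ a P → + 2 * (a * P + (1ℤ + P)) + + 2 * a ≡ (a + 1ℤ) * (+ 2 * (1ℤ + P))
  factor = solve-∀

module _ (P : ℕ) (a : ℤ) where

  floorRowSum : ℕ → ℤ
  floorRowSum μ = Σℤ P (λ j → floorTerm (suc P) a μ (suc j))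

  floorTerm-complement : ¬ + 2 ∣ₛ a → ∀ {μ μ' ν ν'} → μ ℕ.+ μ' ≡ P → ν ℕ.+ ν' ≡ suc P →
                         floorTerm (suc P) a μ' ν' ≡ a - floorTerm (suc P) a μ ν
  -- The two numerators add up to (a+1)·2p and are odd, so ⌊(a+1) - N/2p⌋ = (a+1) - ⌊N/2p⌋ - 1.
  floorTerm-complement 2∤a {μ} {μ'} {ν} {ν'} μ+μ'≡P ν+ν'≡p = trans
    (floorDiv-unique (floorTerm-floorDiv P a μ' ν')
      (floorDiv-complement (a + 1ℤ) (floorTerm-floorDiv P a μ ν) 2p∤N
        (numerator-complement a μ+μ'≡P ν+ν'≡p)))
    (simplify a (floorTerm (suc P) a μ ν))
    where
    2p∤N : ¬ + (2 ℕ.* suc P) ∣ₛ numerator a μ ν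
    2p∤N 2p∣N = numerator-odd μ ν 2∤a (∣-trans (2∣+[2*n] (suc P)) 2p∣N)
    simplify : ∀ a q → a + 1ℤ - q - 1ℤ ≡ a - q
    simplify = solve-∀

  floorRowSum-complement : ¬ + 2 ∣ₛ a → ∀ {μ μ'} → μ ℕ.+ μ' ≡ P →
                           floorRowSum μ' ≡ + P * a - floorRowSum μ
  floorRowSum-complement 2∤a {μ} {μ'} μ+μ'≡P = begin
    floorRowSum μ'                                        ≡⟨ Σℤ-reverse P _ _ reflect ⟩
    Σℤ P (λ j → a - floorTerm (suc P) a μ (suc j))        ≡⟨ Σℤ-sub P (λ _ → a) _ ⟩
    Σℤ P (λ _ → a) - floorRowSum μ                        ≡⟨ cong (_- floorRowSum μ) (Σℤ-const P a) ⟩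
    + P * a - floorRowSum μ                               ∎
    where
    open ≡-Reasoning
    reflect : ∀ i j → suc (i ℕ.+ j) ≡ P →
              floorTerm (suc P) a μ' (suc i) ≡ a - floorTerm (suc P) a μ (suc j)
    reflect i j e =
      floorTerm-complement 2∤a μ+μ'≡P (cong suc (trans (ℕ.+-suc j i) (trans (cong suc (ℕ.+-comm j i)) e)))

  row-congruence : ∀ μ → + 2 ∣ₛ Σℤ (suc P) (λ ν → + μ * legendre (suc P) ν * floorTerm (suc P) a μ ν)
                                 - + μ * floorRowSum μ
  row-congruence μ = subst (+ 2 ∣ₛ_) (sym rearrange) (∣Σℤ P _ λ j j<P →
    subst (+ 2 ∣ₛ_) (sym (factor (+ μ) _ _)) (∣m⇒∣m*n _ (legendre-odd (suc P) j (ℕ.s≤s j<P))))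
    where
    F = floorTerm (suc P) a μ
    χ = legendre (suc P)
    factor : ∀ m c f → m * c * f - m * f ≡ (c - 1ℤ) * (m * f)
    factor = solve-∀
    weighted : ℕ → ℤ
    weighted j = + μ * χ (suc j) * F (suc j)
    unweighted : ℕ → ℤ
    unweighted j = + μ * F (suc j)
    rearrange : Σℤ (suc P) (λ ν → + μ * χ ν * F ν) - + μ * floorRowSum μ
              ≡ Σℤ P (λ j → weighted j - unweighted j)
    rearrange = begin
      Σℤ (suc P) (λ ν → + μ * χ ν * F ν) - + μ * floorRowSum μ
        ≡⟨ cong₂ _-_ (Σℤ-suc P (λ ν → + μ * χ ν * F ν)) (sym (Σℤ-*ˡ P (+ μ) (F ∘ suc))) ⟩
      (+ μ * χ 0 * F 0 + Σℤ P weighted) - Σℤ P unweighted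
        ≡⟨ cong (λ t → (t * F 0 + Σℤ P weighted) - Σℤ P unweighted) (*-zeroʳ (+ μ)) ⟩
      (0ℤ + Σℤ P weighted) - Σℤ P unweighted
        ≡⟨ cong (_- Σℤ P unweighted) (+-identityˡ (Σℤ P weighted)) ⟩
      Σℤ P weighted - Σℤ P unweighted
        ≡⟨ Σℤ-sub P weighted unweighted ⟨
      Σℤ P (λ j → weighted j - unweighted j) ∎
      where open ≡-Reasoning

  weightedRowSums-even : ¬ + 2 ∣ₛ a → ∀ m → P ≡ 2 ℕ.* m → + 2 ∣ₛ + m →
                         + 2 ∣ₛ Σℤ (suc P) (λ μ → + μ * floorRowSum μ)
  weightedRowSums-even 2∤a m refl 2∣m =
    ∣Σℤ-pairs m (λ μ → + μ * H μ) (∣m⇒∣m*n (H m) 2∣m) pair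
    where
    H = floorRowSum
    2∣P : + 2 ∣ₛ + P
    2∣P = 2∣+[2*n] m
    regroup : ∀ i j X H a → i * H + j * (X * a - H) ≡ (i + j) * H + X * (j * a) - + 2 * (j * H)
    regroup = solve-∀
    pair : ∀ i j → i ℕ.+ j ≡ P → + 2 ∣ₛ + i * H i + + j * H j
    pair i j i+j≡P = subst (+ 2 ∣ₛ_) (sym (begin
      + i * H i + + j * H j
        ≡⟨ cong (λ t → + i * H i + + j * t) (floorRowSum-complement 2∤a i+j≡P) ⟩
      + i * H i + + j * (+ P * a - H i)
        ≡⟨ regroup (+ i) (+ j) (+ P) (H i) a ⟩
      (+ i + + j) * H i + + P * (+ j * a) - + 2 * (+ j * H i)
        ≡⟨ cong (λ t → t * H i + + P * (+ j * a) - + 2 * (+ j * H i)) (trans (sym (pos-+ i j)) (cong +_ i+j≡P)) ⟩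
      + P * H i + + P * (+ j * a) - + 2 * (+ j * H i) ∎))
      (∣m∣n⇒∣m-n (∣m∣n⇒∣m+n (∣m⇒∣m*n (H i) 2∣P) (∣m⇒∣m*n (+ j * a) 2∣P)) (∣m⇒∣m*n (+ j * H i) ∣-refl))
      where open ≡-Reasoning

S[½]-even : ∀ p .{{_ : NonZero p}} k a → p ≡ suc (2 ℕ.* (2 ℕ.* k)) → ¬ + 2 ∣ₛ a → + 2 ∣ₛ S p a ½
S[½]-even _ k a refl 2∤a = ∣m+n∣n⇒∣m
  (subst (+ 2 ∣ₛ_) (Σℤ-sub p row weightedRowSum) (∣Σℤ p _ λ μ _ → row-congruence P a μ))
  (∣m⇒∣-m (weightedRowSums-even P a 2∤a (2 ℕ.* k) refl (2∣+[2*n] k)))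
  where
  P = 2 ℕ.* (2 ℕ.* k)
  p = suc P
  row : ℕ → ℤ
  row μ = Σℤ p (λ ν → + μ * legendre p ν * floorTerm p a μ ν)
  weightedRowSum : ℕ → ℤ
  weightedRowSum μ = + μ * floorRowSum P a μ

lemma9p5 : (p : ℕ) .{{_ : NonZero p}} → Prime p → p % 4 ≡ 1 →
    (a : ℤ) → ¬ (+ 2 ∣ a) → Coprime ∣ a ∣ p →
    + 2 ∣ S p a ½
lemma9p5 p _ p%4≡1 a 2∤a _ =
  ∣⇒∣ᵤ (S[½]-even p (p / 4) a p≡4k+1 (2∤a ∘ ∣⇒∣ᵤ))
  where
  rearrange : ∀ k → 1 ℕ.+ k ℕ.* 4 ≡ suc (2 ℕ.* (2 ℕ.* k))
  rearrange = ℕ-Ring.solve-∀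
  p≡4k+1 : p ≡ suc (2 ℕ.* (2 ℕ.* (p / 4)))
  p≡4k+1 = trans (m≡m%n+[m/n]*n p 4) (trans (cong (ℕ._+ p / 4 ℕ.* 4) p%4≡1) (rearrange (p / 4)))
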